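{- For each even positive integer $n$ and each positive odd integer $k<n^2/2+1$ there is a Seidel matrix of a tournament of order $n+2$ whose determinant is $k^2$.
   Context: A tournament of order $m$ is a digraph on $\{1,\dots,m\}$ with exactly one of the arcs $ij$, $ji$ for each pair $i\ne j$. Its Seidel matrix $S=[s_{ij}]$ is the $m\times m$ skew-symmetric matrix with zero diagonal, $s_{ij}=1$ if $ij$ is an arc and $s_{ij}=-1$ otherwise. -}

module Defs where

open import Data.Nat as ℕ using (ℕ; zero; suc)
open import Data.Integer as ℤ using (ℤ; +_; -_; _*_; _+_)
open import Data.Fin using (Fin; zero; suc; punchIn)
open import Data.Bool using (Bool; true; false; if_then_else_)
open import Data.Product using (_×_)
open import Relation.Binary.PropositionalEquality using (_≡_; _≢_)
open import Relation.Nullary using (¬_)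
import Data.Sum
import Data.Fin

Matrix : ℕ → Set
Matrix m = Fin m → Fin m → ℤ

sumFin : ∀ {n} → (Fin n → ℤ) → ℤ
sumFin {zero}  f = + 0
sumFin {suc n} f = f zero + sumFin (λ i → f (suc i))

sign : ℕ → ℤ
sign zero    = + 1
sign (suc k) = - sign k

det : ∀ {m} → Matrix m → ℤ
det {zero}  A = + 1
det {suc m} A =
  sumFin (λ j → sign (Data.Fin.toℕ j) * (A zero j * det (λ r c → A (suc r) (punchIn j c))))

record Tournament (m : ℕ) : Set where
  field
    arc      : Fin m → Fin m → Bool
    loopless : ∀ i → arc i i ≡ false
    oneOf    : ∀ i j → i ≢ j → (arc i j ≡ true × arc j i ≡ false)
                                 Data.Sum.⊎ (arc i j ≡ false × arc j i ≡ true)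

open Tournament public

seidel : ∀ {m} → Tournament m → Matrix m
seidel T i j with Data.Fin._≟_ i j
... | Relation.Nullary.yes _ = + 0
... | Relation.Nullary.no  _ = if arc T i j then + 1 else - (+ 1)

-- Border the Seidel matrix S of the transitive tournament on n = 2P vertices by two vertices:
-- the skew matrix [[S, -x, -y], [xᵀ, 0, s], [yᵀ, -s, 0]] with x_i = (-1)^i, y ∈ {±1}ⁿ and s = ±1
-- is the Seidel matrix of a tournament of order n + 2. The Schur complement of the leading block
-- [[0,1],[-1,0]] of S is a bordered matrix of the same kind of order two less (x is only shifted
-- by 2), so by induction the determinant is the square of the Pfaffian s + Σ_j w_j y_j with
-- w_j = (-1)^j (2j + 1 - n). The |w_j| are 1, 1, 3, 3, …, n - 1, n - 1, whose subset sums are all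
-- of 0, …, n²/2, so for s = 1 the Pfaffian takes every odd value from 1 to n²/2 + 1.

module Submission where

open import Defs
open import Data.Nat using (ℕ; zero; suc; z≤n; s≤s; z<s; s<s; _<_; _≤_; _≟_; _<?_)
import Data.Nat as ℕ
import Data.Nat.Properties as ℕ
open import Data.Integer as ℤ using (ℤ; +_; 0ℤ; 1ℤ; -1ℤ)
import Data.Integer.Properties as ℤ
open import Data.Integer.Tactic.RingSolver using (solve-∀)
import Data.Nat.Tactic.RingSolver as ℕ-Solver
open import Data.Fin as Fin using (Fin; toℕ; punchIn)
import Data.Fin.Properties as Fin
open import Data.Product using (Σ; ∃-syntax; _×_; _,_)
open import Data.Sum using (_⊎_; inj₁; inj₂)
open import Function using (_∘_)
open import Relation.Nullary using (¬_; Dec; yes; no; contradiction)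
open import Relation.Binary.PropositionalEquality
open import Relation.Binary.Definitions using (tri<; tri≈; tri>)

module Determinant where

  open import Data.Integer using (_+_; _*_; _-_; -_)
  open import Algebra.Properties.AbelianGroup ℤ.+-0-abelianGroup using (inverseʳ-unique)
  open ≡-Reasoning

  -- Indexing by ℕ spares minors any Fin arithmetic; detN agrees with det (det≡detN) and only
  -- reads the entries below the order.
  ℕMatrix : Set
  ℕMatrix = ℕ → ℕ → ℤ

  sumTo : ℕ → (ℕ → ℤ) → ℤ
  sumTo zero    f = 0ℤ
  sumTo (suc m) f = f 0 + sumTo m (f ∘ suc)

  sumTo-cong : ∀ m {f g : ℕ → ℤ} → (∀ j → j < m → f j ≡ g j) → sumTo m f ≡ sumTo m g
  sumTo-cong zero    f≗g = refl
  sumTo-cong (suc m) f≗g = cong₂ _+_ (f≗g 0 z<s) (sumTo-cong m λ j j<m → f≗g (suc j) (s<s j<m))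

  sumTo-zero : ∀ m {f : ℕ → ℤ} → (∀ j → j < m → f j ≡ 0ℤ) → sumTo m f ≡ 0ℤ
  sumTo-zero zero    f≗0 = refl
  sumTo-zero (suc m) f≗0 = cong₂ _+_ (f≗0 0 z<s) (sumTo-zero m λ j j<m → f≗0 (suc j) (s<s j<m))

  sumTo-linear : ∀ m a (f g : ℕ → ℤ) → sumTo m (λ j → f j + a * g j) ≡ sumTo m f + a * sumTo m g
  sumTo-linear zero    a f g = sym (trans (ℤ.+-identityˡ _) (ℤ.*-zeroʳ a))
  sumTo-linear (suc m) a f g = begin
    f 0 + a * g 0 + sumTo m (λ j → f (suc j) + a * g (suc j))
      ≡⟨ cong (_+_ (f 0 + a * g 0)) (sumTo-linear m a (f ∘ suc) (g ∘ suc)) ⟩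
    f 0 + a * g 0 + (sumTo m (f ∘ suc) + a * sumTo m (g ∘ suc))
      ≡⟨ regroup (f 0) (g 0) (sumTo m (f ∘ suc)) (sumTo m (g ∘ suc)) a ⟩
    f 0 + sumTo m (f ∘ suc) + a * (g 0 + sumTo m (g ∘ suc)) ∎
    where
    regroup : ∀ x y u v a → x + a * y + (u + a * v) ≡ x + u + a * (y + v)
    regroup = solve-∀

  sumTo-snoc : ∀ m (f : ℕ → ℤ) → sumTo (suc m) f ≡ sumTo m f + f m
  sumTo-snoc zero    f = trans (ℤ.+-identityʳ (f 0)) (sym (ℤ.+-identityˡ (f 0)))
  sumTo-snoc (suc m) f = trans (cong (_+_ (f 0)) (sumTo-snoc m (f ∘ suc))) (sym (ℤ.+-assoc (f 0) _ _))

  sumTo-adjacentPair : ∀ m c {f : ℕ → ℤ} → suc c < m →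
    (∀ j → j < m → j ≢ c → j ≢ suc c → f j ≡ 0ℤ) → f c + f (suc c) ≡ 0ℤ → sumTo m f ≡ 0ℤ
  sumTo-adjacentPair (suc (suc m)) zero {f} _ others pair = begin
    f 0 + (f 1 + sumTo m (f ∘ suc ∘ suc)) ≡⟨ ℤ.+-assoc (f 0) (f 1) _ ⟨
    f 0 + f 1 + sumTo m (f ∘ suc ∘ suc)   ≡⟨ cong₂ _+_ pair (sumTo-zero m λ j j<m → others (2 ℕ.+ j) (s<s (s<s j<m)) (λ ()) (λ ())) ⟩
    0ℤ + 0ℤ                               ≡⟨⟩
    0ℤ ∎
  sumTo-adjacentPair (suc m) (suc c) (s<s c<m) others pair =
    cong₂ _+_ (others 0 z<s (λ ()) (λ ()))
      (sumTo-adjacentPair m c c<m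
        (λ j j<m j≢c j≢c+1 → others (suc j) (s<s j<m) (j≢c ∘ ℕ.suc-injective) (j≢c+1 ∘ ℕ.suc-injective)) pair)

  punchInℕ : ℕ → ℕ → ℕ
  punchInℕ zero    c       = suc c
  punchInℕ (suc j) zero    = zero
  punchInℕ (suc j) (suc c) = suc (punchInℕ j c)

  punchInℕ≢ : ∀ j c → punchInℕ j c ≢ j
  punchInℕ≢ (suc j) (suc c) eq = punchInℕ≢ j c (ℕ.suc-injective eq)

  punchInℕ-injective : ∀ j a b → punchInℕ j a ≡ punchInℕ j b → a ≡ b
  punchInℕ-injective zero    a       b       eq = ℕ.suc-injective eq
  punchInℕ-injective (suc j) zero    zero    eq = refl
  punchInℕ-injective (suc j) (suc a) (suc b) eq = cong suc (punchInℕ-injective j a b (ℕ.suc-injective eq))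

  punchInℕ-< : ∀ {m} j c → c < m → punchInℕ j c < suc m
  punchInℕ-< zero    c       c<m       = s<s c<m
  punchInℕ-< (suc j) zero    c<m       = z<s
  punchInℕ-< (suc j) (suc c) (s<s c<m) = s<s (punchInℕ-< j c c<m)

  punchInℕ-surjective : ∀ m j c → j ≤ m → c < suc m → c ≢ j → ∃[ c′ ] c′ < m × punchInℕ j c′ ≡ c
  punchInℕ-surjective m       zero    zero    _         _         c≢j = contradiction refl c≢j
  punchInℕ-surjective m       zero    (suc c) _         (s<s c<m) _   = c , c<m , refl
  punchInℕ-surjective (suc m) (suc j) zero    _         _         _   = 0 , z<s , refl
  punchInℕ-surjective (suc m) (suc j) (suc c) (s≤s j≤m) (s<s c<m) c≢j
    with c′ , c′<m , eq ← punchInℕ-surjective m j c j≤m c<m (c≢j ∘ cong suc)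
    = suc c′ , s<s c′<m , cong suc eq

  punchInℕ-surjectiveAdjacent : ∀ m j c → j ≤ m → suc c < suc m → j ≢ c → j ≢ suc c →
    ∃[ c′ ] suc c′ < m × punchInℕ j c′ ≡ c × punchInℕ j (suc c′) ≡ suc c
  punchInℕ-surjectiveAdjacent m             zero          zero    _ _ j≢c _ = contradiction refl j≢c
  punchInℕ-surjectiveAdjacent m             zero          (suc c) _ (s<s c<m) _ _ = c , c<m , refl , refl
  punchInℕ-surjectiveAdjacent m             (suc zero)    zero    _ _ _ j≢c+1 = contradiction refl j≢c+1
  punchInℕ-surjectiveAdjacent (suc (suc m)) (suc (suc j)) zero    _ _ _ _ = 0 , s<s z<s , refl , refl
  punchInℕ-surjectiveAdjacent (suc m)       (suc j)       (suc c) (s≤s j≤m) (s<s c<m) j≢c j≢c+1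
    with c′ , c′<m , eq , eq′ ← punchInℕ-surjectiveAdjacent m j c j≤m c<m (j≢c ∘ cong suc) (j≢c+1 ∘ cong suc)
    = suc c′ , s<s c′<m , cong suc eq , cong suc eq′

  punchInℕ-adjacent : ∀ (g : ℕ → ℤ) c d → g c ≡ g (suc c) → g (punchInℕ c d) ≡ g (punchInℕ (suc c) d)
  punchInℕ-adjacent g zero    zero    eq = sym eq
  punchInℕ-adjacent g zero    (suc d) eq = refl
  punchInℕ-adjacent g (suc c) zero    eq = refl
  punchInℕ-adjacent g (suc c) (suc d) eq = punchInℕ-adjacent (g ∘ suc) c d eq

  minor : ℕMatrix → ℕ → ℕMatrix
  minor f j r c = f (suc r) (punchInℕ j c)

  detN : ℕ → ℕMatrix → ℤ
  cofactorTerm : ℕ → ℕMatrix → ℕ → ℤ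

  detN zero    f = 1ℤ
  detN (suc m) f = sumTo (suc m) (cofactorTerm m f)

  cofactorTerm m f j = sign j * (f 0 j * detN m (minor f j))

  detN-cong : ∀ m {f g : ℕMatrix} → (∀ r c → r < m → c < m → f r c ≡ g r c) → detN m f ≡ detN m g
  detN-cong zero    f≗g = refl
  detN-cong (suc m) f≗g = sumTo-cong (suc m) λ j j<m+1 →
    cong₂ (λ a d → sign j * (a * d)) (f≗g 0 j z<s j<m+1)
      (detN-cong m λ r c r<m c<m → f≗g (suc r) (punchInℕ j c) (s<s r<m) (punchInℕ-< j c c<m))

  minor-agreeOff : ∀ j {c c′} {f g : ℕMatrix} → punchInℕ j c′ ≡ c →
    (∀ r d → d ≢ c → f r d ≡ g r d) → ∀ r d → d ≢ c′ → minor f j r d ≡ minor g j r d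
  minor-agreeOff j {c′ = c′} eq f≗g r d d≢c′ =
    f≗g (suc r) (punchInℕ j d) (λ e → d≢c′ (punchInℕ-injective j d c′ (trans e (sym eq))))

  cofactorTerm-linearAt : ∀ m c {f g h : ℕMatrix} (a : ℤ) →
    (∀ r d → d ≢ c → f r d ≡ g r d) → (∀ r d → d ≢ c → f r d ≡ h r d) →
    (∀ r → f r c ≡ g r c + a * h r c) → cofactorTerm m f c ≡ cofactorTerm m g c + a * cofactorTerm m h c
  cofactorTerm-linearAt m c {f} {g} {h} a f≗g f≗h fc = begin
    sign c * (f 0 c * detN m (minor f c))
      ≡⟨ cong (λ x → sign c * (x * detN m (minor f c))) (fc 0) ⟩
    sign c * ((g 0 c + a * h 0 c) * detN m (minor f c))
      ≡⟨ distribute (sign c) (g 0 c) (h 0 c) (detN m (minor f c)) a ⟩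
    sign c * (g 0 c * detN m (minor f c)) + a * (sign c * (h 0 c * detN m (minor f c)))
      ≡⟨ cong₂ (λ dg dh → sign c * (g 0 c * dg) + a * (sign c * (h 0 c * dh)))
           (detN-cong m λ r d _ _ → f≗g (suc r) (punchInℕ c d) (punchInℕ≢ c d))
           (detN-cong m λ r d _ _ → f≗h (suc r) (punchInℕ c d) (punchInℕ≢ c d)) ⟩
    sign c * (g 0 c * detN m (minor g c)) + a * (sign c * (h 0 c * detN m (minor h c))) ∎
    where
    distribute : ∀ s x y d a → s * ((x + a * y) * d) ≡ s * (x * d) + a * (s * (y * d))
    distribute = solve-∀

  detN-linear : ∀ m c {f g h : ℕMatrix} (a : ℤ) → c < m →
    (∀ r d → d ≢ c → f r d ≡ g r d) → (∀ r d → d ≢ c → f r d ≡ h r d) →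
    (∀ r → f r c ≡ g r c + a * h r c) → detN m f ≡ detN m g + a * detN m h
  detN-linear (suc m) c {f} {g} {h} a c<m+1 f≗g f≗h fc =
    trans (sumTo-cong (suc m) termwise) (sumTo-linear (suc m) a (cofactorTerm m g) (cofactorTerm m h))
    where
    termwise : ∀ j → j < suc m → cofactorTerm m f j ≡ cofactorTerm m g j + a * cofactorTerm m h j
    termwise j j<m+1 with j ≟ c
    ... | yes refl = cofactorTerm-linearAt m j a f≗g f≗h fc
    ... | no j≢c with c′ , c′<m , eq ← punchInℕ-surjective m j c (ℕ.≤-pred j<m+1) c<m+1 (j≢c ∘ sym) = begin
      sign j * (f 0 j * detN m (minor f j))
        ≡⟨ cong (λ d → sign j * (f 0 j * d))
             (detN-linear m c′ a c′<m (minor-agreeOff j eq f≗g) (minor-agreeOff j eq f≗h)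
               (λ r → subst (λ d → f (suc r) d ≡ g (suc r) d + a * h (suc r) d) (sym eq) (fc (suc r)))) ⟩
      sign j * (f 0 j * (detN m (minor g j) + a * detN m (minor h j)))
        ≡⟨ distribute (sign j) (f 0 j) (detN m (minor g j)) (detN m (minor h j)) a ⟩
      sign j * (f 0 j * detN m (minor g j)) + a * (sign j * (f 0 j * detN m (minor h j)))
        ≡⟨ cong₂ (λ x y → sign j * (x * detN m (minor g j)) + a * (sign j * (y * detN m (minor h j))))
             (f≗g 0 j j≢c) (f≗h 0 j j≢c) ⟩
      sign j * (g 0 j * detN m (minor g j)) + a * (sign j * (h 0 j * detN m (minor h j))) ∎
      where
      distribute : ∀ s x u v a → s * (x * (u + a * v)) ≡ s * (x * u) + a * (s * (x * v))
      distribute = solve-∀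

  detN-adjacentEqual : ∀ m c {f : ℕMatrix} → suc c < m → (∀ r → f r c ≡ f r (suc c)) → detN m f ≡ 0ℤ
  detN-adjacentEqual (suc m) c {f} c+1<m+1 fc≗fc+1 = sumTo-adjacentPair (suc m) c c+1<m+1 others pair
    where
    others : ∀ j → j < suc m → j ≢ c → j ≢ suc c → cofactorTerm m f j ≡ 0ℤ
    others j j<m+1 j≢c j≢c+1
      with c′ , c′+1<m , eq , eq′ ← punchInℕ-surjectiveAdjacent m j c (ℕ.≤-pred j<m+1) c+1<m+1 j≢c j≢c+1 = begin
      sign j * (f 0 j * detN m (minor f j))
        ≡⟨ cong (λ d → sign j * (f 0 j * d)) (detN-adjacentEqual m c′ c′+1<m λ r →
             subst₂ (λ d d′ → f (suc r) d ≡ f (suc r) d′) (sym eq) (sym eq′) (fc≗fc+1 (suc r))) ⟩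
      sign j * (f 0 j * 0ℤ)
        ≡⟨ cong (sign j *_) (ℤ.*-zeroʳ (f 0 j)) ⟩
      sign j * 0ℤ
        ≡⟨ ℤ.*-zeroʳ (sign j) ⟩
      0ℤ ∎
    cancel : ∀ s x d → s * (x * d) + - s * (x * d) ≡ 0ℤ
    cancel = solve-∀
    pair : cofactorTerm m f c + cofactorTerm m f (suc c) ≡ 0ℤ
    pair = begin
      sign c * (f 0 c * detN m (minor f c)) + - sign c * (f 0 (suc c) * detN m (minor f (suc c)))
        ≡⟨ cong₂ (λ x d → sign c * (f 0 c * detN m (minor f c)) + - sign c * (x * d)) (sym (fc≗fc+1 0))
             (detN-cong m λ r d _ _ → sym (punchInℕ-adjacent (f (suc r)) c d (fc≗fc+1 (suc r)))) ⟩
      sign c * (f 0 c * detN m (minor f c)) + - sign c * (f 0 c * detN m (minor f c))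
        ≡⟨ cancel (sign c) (f 0 c) (detN m (minor f c)) ⟩
      0ℤ ∎

  setColumn : ℕ → (ℕ → ℤ) → ℕMatrix → ℕMatrix
  setColumn c v f r d with d ≟ c
  ... | yes _ = v r
  ... | no  _ = f r d

  setColumn-≡ : ∀ c v f r → setColumn c v f r c ≡ v r
  setColumn-≡ c v f r with c ≟ c
  ... | yes _   = refl
  ... | no  c≢c = contradiction refl c≢c

  setColumn-≢ : ∀ c v f r {d} → d ≢ c → setColumn c v f r d ≡ f r d
  setColumn-≢ c v f r {d} d≢c with d ≟ c
  ... | yes d≡c = contradiction d≡c d≢c
  ... | no  _   = refl

  withColumns : ℕ → (ℕ → ℤ) → (ℕ → ℤ) → ℕMatrix → ℕMatrix
  withColumns c u v f = setColumn c u (setColumn (suc c) v f)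

  withColumns-fst : ∀ c u v f r → withColumns c u v f r c ≡ u r
  withColumns-fst c u v f = setColumn-≡ c u _

  withColumns-snd : ∀ c u v f r → withColumns c u v f r (suc c) ≡ v r
  withColumns-snd c u v f r = trans (setColumn-≢ c u _ r ℕ.1+n≢n) (setColumn-≡ (suc c) v f r)

  withColumns-other : ∀ c u v f r {d} → d ≢ c → d ≢ suc c → withColumns c u v f r d ≡ f r d
  withColumns-other c u v f r d≢c d≢c+1 = trans (setColumn-≢ c u _ r d≢c) (setColumn-≢ (suc c) v f r d≢c+1)

  withColumns-unique : ∀ c u v f {g : ℕMatrix} → (∀ r → g r c ≡ u r) → (∀ r → g r (suc c) ≡ v r) →
    (∀ r d → d ≢ c → d ≢ suc c → g r d ≡ f r d) → ∀ r d → withColumns c u v f r d ≡ g r d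
  withColumns-unique c u v f gc gc+1 g≗f r d = byCases (d ≟ c) (d ≟ suc c)
    where
    byCases : Dec (d ≡ c) → Dec (d ≡ suc c) → withColumns c u v f r d ≡ _
    byCases (yes refl) _          = trans (withColumns-fst c u v f r) (sym (gc r))
    byCases (no  _)    (yes refl) = trans (withColumns-snd c u v f r) (sym (gc+1 r))
    byCases (no  d≢c)  (no d≢c+1) = trans (withColumns-other c u v f r d≢c d≢c+1) (sym (g≗f r d d≢c d≢c+1))

  withColumns-agreeOffFst : ∀ c u u′ v f r {d} → d ≢ c → withColumns c u v f r d ≡ withColumns c u′ v f r d
  withColumns-agreeOffFst c u u′ v f r d≢c = trans (setColumn-≢ c u _ r d≢c) (sym (setColumn-≢ c u′ _ r d≢c))

  withColumns-agreeOffSnd : ∀ c u v v′ f r d → d ≢ suc c → withColumns c u v f r d ≡ withColumns c u v′ f r d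
  withColumns-agreeOffSnd c u v v′ f r d d≢c+1 = byCases (d ≟ c)
    where
    byCases : Dec (d ≡ c) → withColumns c u v f r d ≡ withColumns c u v′ f r d
    byCases (yes refl) = trans (withColumns-fst c u v f r) (sym (withColumns-fst c u v′ f r))
    byCases (no  d≢c)  =
      trans (withColumns-other c u v f r d≢c d≢c+1) (sym (withColumns-other c u v′ f r d≢c d≢c+1))

  detN-withColumns-antisymmetric : ∀ m c f u v → suc c < m →
    detN m (withColumns c u v f) + detN m (withColumns c v u f) ≡ 0ℤ
  detN-withColumns-antisymmetric m c f u v c+1<m = begin
    D u v + D v u
      ≡⟨ pad (D u v) (D v u) ⟩
    (0ℤ + 1ℤ * D u v) + 1ℤ * (D v u + 1ℤ * 0ℤ)
      ≡⟨ cong₂ (λ x y → (x + 1ℤ * D u v) + 1ℤ * (D v u + 1ℤ * y)) (vanish u) (vanish v) ⟨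
    (D u u + 1ℤ * D u v) + 1ℤ * (D v u + 1ℤ * D v v)
      ≡⟨ cong₂ (λ x y → x + 1ℤ * y) (linearSnd u) (linearSnd v) ⟨
    D u w + 1ℤ * D v w
      ≡⟨ linearFst ⟨
    D w w
      ≡⟨ vanish w ⟩
    0ℤ ∎
    where
    D : (ℕ → ℤ) → (ℕ → ℤ) → ℤ
    D a b = detN m (withColumns c a b f)
    w : ℕ → ℤ
    w r = u r + v r
    pad : ∀ x y → x + y ≡ (0ℤ + 1ℤ * x) + 1ℤ * (y + 1ℤ * 0ℤ)
    pad = solve-∀
    w≡u+1*v : ∀ r → w r ≡ u r + 1ℤ * v r
    w≡u+1*v r = cong (_+_ (u r)) (sym (ℤ.*-identityˡ (v r)))
    vanish : ∀ a → D a a ≡ 0ℤ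
    vanish a = detN-adjacentEqual m c c+1<m λ r → trans (withColumns-fst c a a f r) (sym (withColumns-snd c a a f r))
    linearFst : D w w ≡ D u w + 1ℤ * D v w
    linearFst = detN-linear m c 1ℤ (ℕ.<-trans (ℕ.n<1+n c) c+1<m)
      (λ r d → withColumns-agreeOffFst c w u w f r) (λ r d → withColumns-agreeOffFst c w v w f r)
      λ r → trans (withColumns-fst c w w f r) (trans (w≡u+1*v r)
              (sym (cong₂ (λ x y → x + 1ℤ * y) (withColumns-fst c u w f r) (withColumns-fst c v w f r))))
    linearSnd : ∀ a → D a w ≡ D a u + 1ℤ * D a v
    linearSnd a = detN-linear m (suc c) 1ℤ c+1<m
      (withColumns-agreeOffSnd c a w u f) (withColumns-agreeOffSnd c a w v f)
      λ r → trans (withColumns-snd c a w f r) (trans (w≡u+1*v r)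
              (sym (cong₂ (λ x y → x + 1ℤ * y) (withColumns-snd c a u f r) (withColumns-snd c a v f r))))

  transposeAdjacent : ℕ → ℕ → ℕ
  transposeAdjacent zero    zero          = 1
  transposeAdjacent zero    (suc zero)    = 0
  transposeAdjacent zero    (suc (suc d)) = suc (suc d)
  transposeAdjacent (suc c) zero          = zero
  transposeAdjacent (suc c) (suc d)       = suc (transposeAdjacent c d)

  transposeAdjacent-fst : ∀ c → transposeAdjacent c c ≡ suc c
  transposeAdjacent-fst zero    = refl
  transposeAdjacent-fst (suc c) = cong suc (transposeAdjacent-fst c)

  transposeAdjacent-snd : ∀ c → transposeAdjacent c (suc c) ≡ c
  transposeAdjacent-snd zero    = refl
  transposeAdjacent-snd (suc c) = cong suc (transposeAdjacent-snd c)

  transposeAdjacent-other : ∀ c d → d ≢ c → d ≢ suc c → transposeAdjacent c d ≡ d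
  transposeAdjacent-other zero    zero          d≢c _     = contradiction refl d≢c
  transposeAdjacent-other zero    (suc zero)    _   d≢c+1 = contradiction refl d≢c+1
  transposeAdjacent-other zero    (suc (suc d)) _   _     = refl
  transposeAdjacent-other (suc c) zero          _   _     = refl
  transposeAdjacent-other (suc c) (suc d) d≢c d≢c+1 =
    cong suc (transposeAdjacent-other c d (d≢c ∘ cong suc) (d≢c+1 ∘ cong suc))

  detN-transposeAdjacent : ∀ m c {f : ℕMatrix} → suc c < m →
    detN m (λ r d → f r (transposeAdjacent c d)) ≡ - detN m f
  detN-transposeAdjacent m c {f} c+1<m = begin
    detN m (λ r d → f r (transposeAdjacent c d))
      ≡⟨ detN-cong m (λ r d _ _ → withColumns-unique c v u f
           (λ r → cong (f r) (transposeAdjacent-fst c)) (λ r → cong (f r) (transposeAdjacent-snd c))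
           (λ r d d≢c d≢c+1 → cong (f r) (transposeAdjacent-other c d d≢c d≢c+1)) r d) ⟨
    detN m (withColumns c v u f)
      ≡⟨ inverseʳ-unique _ _ (detN-withColumns-antisymmetric m c f u v c+1<m) ⟩
    - detN m (withColumns c u v f)
      ≡⟨ cong -_ (detN-cong m λ r d _ _ →
           withColumns-unique c u v f (λ _ → refl) (λ _ → refl) (λ _ _ _ _ → refl) r d) ⟩
    - detN m f ∎
    where
    u v : ℕ → ℤ
    u r = f r c
    v r = f r (suc c)

  detN-equalColumns : ∀ m c d {f : ℕMatrix} → c < d → d < m → (∀ r → f r c ≡ f r d) → detN m f ≡ 0ℤ
  detN-equalColumns m c (suc d) {f} c<d+1 d+1<m fc≗fd with ℕ.m<1+n⇒m<n∨m≡n c<d+1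
  ... | inj₂ refl = detN-adjacentEqual m c d+1<m fc≗fd
  ... | inj₁ c<d  = begin
    detN m f
      ≡⟨ ℤ.neg-involutive (detN m f) ⟨
    - - detN m f
      ≡⟨ cong -_ (detN-transposeAdjacent m d d+1<m) ⟨
    - detN m (λ r e → f r (transposeAdjacent d e))
      ≡⟨ cong -_ (detN-equalColumns m c d c<d (ℕ.<-trans (ℕ.n<1+n d) d+1<m) λ r →
           trans (cong (f r) (transposeAdjacent-other d c (ℕ.<⇒≢ c<d) (ℕ.<⇒≢ c<d+1)))
             (trans (fc≗fd r) (cong (f r) (sym (transposeAdjacent-fst d))))) ⟩
    - 0ℤ
      ≡⟨⟩
    0ℤ ∎

  detN-addColumn : ∀ m c d {f g : ℕMatrix} (a : ℤ) → c < m → d < m → c ≢ d →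
    (∀ r e → e ≢ c → g r e ≡ f r e) → (∀ r → g r c ≡ f r c + a * f r d) → detN m g ≡ detN m f
  detN-addColumn m c d {f} {g} a c<m d<m c≢d g≗f gc = begin
    detN m g
      ≡⟨ detN-linear m c a c<m g≗f (λ r e e≢c → trans (g≗f r e e≢c) (sym (setColumn-≢ c fd f r e≢c)))
           (λ r → trans (gc r) (cong (λ x → f r c + a * x) (sym (setColumn-≡ c fd f r)))) ⟩
    detN m f + a * detN m h
      ≡⟨ cong (λ x → detN m f + a * x) hVanishes ⟩
    detN m f + a * 0ℤ
      ≡⟨ cong (_+_ (detN m f)) (ℤ.*-zeroʳ a) ⟩
    detN m f + 0ℤ
      ≡⟨ ℤ.+-identityʳ (detN m f) ⟩
    detN m f ∎
    where
    fd : ℕ → ℤ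
    fd r = f r d
    h : ℕMatrix
    h = setColumn c fd f
    hc≗hd : ∀ r → h r c ≡ h r d
    hc≗hd r = trans (setColumn-≡ c fd f r) (sym (setColumn-≢ c fd f r (c≢d ∘ sym)))
    hVanishes : detN m h ≡ 0ℤ
    hVanishes with ℕ.<-cmp c d
    ... | tri< c<d _ _ = detN-equalColumns m c d c<d d<m hc≗hd
    ... | tri≈ _ c≡d _ = contradiction c≡d c≢d
    ... | tri> _ _ d<c = detN-equalColumns m d c d<c c<m (sym ∘ hc≗hd)

  detN-unitFirstRow : ∀ m {f : ℕMatrix} → f 0 0 ≡ 1ℤ → (∀ c → c < m → f 0 (suc c) ≡ 0ℤ) →
    detN (suc m) f ≡ detN m (λ r c → f (suc r) (suc c))
  detN-unitFirstRow m {f} f00≡1 row0≡0 = begin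
    1ℤ * (f 0 0 * D) + sumTo m (cofactorTerm m f ∘ suc)
      ≡⟨ cong₂ (λ x y → 1ℤ * (x * D) + y) f00≡1 (sumTo-zero m λ c c<m →
           trans (cong (λ x → sign (suc c) * (x * detN m (minor f (suc c)))) (row0≡0 c c<m)) (ℤ.*-zeroʳ (sign (suc c)))) ⟩
    1ℤ * (1ℤ * D) + 0ℤ
      ≡⟨ simplify D ⟩
    D ∎
    where
    D : ℤ
    D = detN m (λ r c → f (suc r) (suc c))
    simplify : ∀ x → 1ℤ * (1ℤ * x) + 0ℤ ≡ x
    simplify = solve-∀

  subtractFirstColumn : ℕ → ℕMatrix → ℕMatrix
  subtractFirstColumn k f r zero = f r zero
  subtractFirstColumn k f r (suc c) with c <? k
  ... | yes _ = f r (suc c) - f 0 (suc c) * f r 0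
  ... | no  _ = f r (suc c)

  subtractFirstColumn-< : ∀ k f r c → c < k → subtractFirstColumn k f r (suc c) ≡ f r (suc c) - f 0 (suc c) * f r 0
  subtractFirstColumn-< k f r c c<k with c <? k
  ... | yes _   = refl
  ... | no  c≮k = contradiction c<k c≮k

  subtractFirstColumn-≮ : ∀ k f r c → ¬ c < k → subtractFirstColumn k f r (suc c) ≡ f r (suc c)
  subtractFirstColumn-≮ k f r c c≮k with c <? k
  ... | yes c<k = contradiction c<k c≮k
  ... | no  _   = refl

  detN-subtractFirstColumn : ∀ m k f → k ≤ m → detN (suc m) (subtractFirstColumn k f) ≡ detN (suc m) f
  detN-subtractFirstColumn m zero    f _   = detN-cong (suc m) {subtractFirstColumn 0 f} {f} λ where
    r zero    _ _ → refl
    r (suc c) _ _ → subtractFirstColumn-≮ 0 f r c λ ()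
  detN-subtractFirstColumn m (suc k) f k<m = trans
    (detN-addColumn (suc m) (suc k) 0 (- f 0 (suc k)) (s<s k<m) z<s (λ ()) unchanged changed)
    (detN-subtractFirstColumn m k f (ℕ.<⇒≤ k<m))
    where
    unchanged : ∀ r e → e ≢ suc k → subtractFirstColumn (suc k) f r e ≡ subtractFirstColumn k f r e
    unchanged r zero    _       = refl
    unchanged r (suc e) e+1≢k+1 with e <? suc k | e <? k
    ... | yes _        | yes _   = refl
    ... | no  _        | no  _   = refl
    ... | yes e<k+1    | no  e≮k = contradiction (cong suc (ℕ.≤-antisym (ℕ.≤-pred e<k+1) (ℕ.≮⇒≥ e≮k))) e+1≢k+1
    ... | no  e≮k+1    | yes e<k = contradiction (ℕ.<-trans e<k (ℕ.n<1+n k)) e≮k+1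
    subtract : ∀ x y z → x - y * z ≡ x + - y * z
    subtract = solve-∀
    changed : ∀ r → subtractFirstColumn (suc k) f r (suc k) ≡ subtractFirstColumn k f r (suc k) + - f 0 (suc k) * f r 0
    changed r = begin
      subtractFirstColumn (suc k) f r (suc k)   ≡⟨ subtractFirstColumn-< (suc k) f r k (ℕ.n<1+n k) ⟩
      f r (suc k) - f 0 (suc k) * f r 0         ≡⟨ subtract (f r (suc k)) (f 0 (suc k)) (f r 0) ⟩
      f r (suc k) + - f 0 (suc k) * f r 0
        ≡⟨ cong (λ x → x + - f 0 (suc k) * f r 0) (subtractFirstColumn-≮ k f r k (ℕ.<-irrefl refl)) ⟨
      subtractFirstColumn k f r (suc k) + - f 0 (suc k) * f r 0 ∎

  detN-pivot₁ : ∀ m {f : ℕMatrix} → f 0 0 ≡ 1ℤ →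
    detN (suc m) f ≡ detN m (λ r c → f (suc r) (suc c) - f 0 (suc c) * f (suc r) 0)
  detN-pivot₁ m {f} f00≡1 = begin
    detN (suc m) f
      ≡⟨ detN-subtractFirstColumn m m f ℕ.≤-refl ⟨
    detN (suc m) (subtractFirstColumn m f)
      ≡⟨ detN-unitFirstRow m {subtractFirstColumn m f} f00≡1 row0≡0 ⟩
    detN m (λ r c → subtractFirstColumn m f (suc r) (suc c))
      ≡⟨ detN-cong m (λ r c _ c<m → subtractFirstColumn-< m f (suc r) c c<m) ⟩
    detN m (λ r c → f (suc r) (suc c) - f 0 (suc c) * f (suc r) 0) ∎
    where
    cancel : ∀ x → x - x * 1ℤ ≡ 0ℤ
    cancel = solve-∀
    row0≡0 : ∀ c → c < m → subtractFirstColumn m f 0 (suc c) ≡ 0ℤ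
    row0≡0 c c<m = begin
      subtractFirstColumn m f 0 (suc c)        ≡⟨ subtractFirstColumn-< m f 0 c c<m ⟩
      f 0 (suc c) - f 0 (suc c) * f 0 0        ≡⟨ cong (λ x → f 0 (suc c) - f 0 (suc c) * x) f00≡1 ⟩
      f 0 (suc c) - f 0 (suc c) * 1ℤ           ≡⟨ cancel (f 0 (suc c)) ⟩
      0ℤ ∎

  -- The Schur complement of a leading block [[0,1],[-1,0]].
  detN-pivot₂ : ∀ m {f : ℕMatrix} → f 0 0 ≡ 0ℤ → f 0 1 ≡ 1ℤ → f 1 0 ≡ -1ℤ → f 1 1 ≡ 0ℤ →
    detN (2 ℕ.+ m) f ≡
    detN m (λ r c → f (2 ℕ.+ r) (2 ℕ.+ c) - f 0 (2 ℕ.+ c) * f (2 ℕ.+ r) 1 + f 1 (2 ℕ.+ c) * f (2 ℕ.+ r) 0)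
  detN-pivot₂ m {f} f00≡0 f01≡1 f10≡-1 f11≡0 = begin
    detN (2 ℕ.+ m) f   ≡⟨ detN-addColumn (2 ℕ.+ m) 0 1 {f} {g} 1ℤ z<s (s<s z<s) (λ ()) g≗f
                            (λ r → cong (_+_ (f r 0)) (sym (ℤ.*-identityˡ (f r 1)))) ⟨
    detN (2 ℕ.+ m) g   ≡⟨ detN-pivot₁ (suc m) {g} (cong₂ _+_ f00≡0 f01≡1) ⟩
    detN (suc m) h     ≡⟨ detN-pivot₁ m {h} (h00≡1 f11≡0 f01≡1 f10≡-1) ⟩
    detN m (λ r c → h (suc r) (suc c) - h 0 (suc c) * h (suc r) 0)
      ≡⟨ detN-cong m (λ r c _ _ → eliminate (f (2 ℕ.+ r) (2 ℕ.+ c)) (f 0 (2 ℕ.+ c)) (f (2 ℕ.+ r) 0) (f (2 ℕ.+ r) 1)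
                                     (f 1 (2 ℕ.+ c)) f10≡-1 f11≡0 f01≡1) ⟩
    detN m (λ r c → f (2 ℕ.+ r) (2 ℕ.+ c) - f 0 (2 ℕ.+ c) * f (2 ℕ.+ r) 1 + f 1 (2 ℕ.+ c) * f (2 ℕ.+ r) 0) ∎
    where
    g : ℕMatrix
    g r zero    = f r 0 + f r 1
    g r (suc c) = f r (suc c)
    g≗f : ∀ r e → e ≢ 0 → g r e ≡ f r e
    g≗f r zero    0≢0 = contradiction refl 0≢0
    g≗f r (suc e) _   = refl
    h : ℕMatrix
    h r c = g (suc r) (suc c) - g 0 (suc c) * g (suc r) 0
    h00≡1 : ∀ {p q t} → q ≡ 0ℤ → t ≡ 1ℤ → p ≡ -1ℤ → q - t * (p + q) ≡ 1ℤ
    h00≡1 refl refl refl = refl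
    identity : ∀ A B C D E → (A - B * (C + D)) - (E - B * (-1ℤ + 0ℤ)) * (D - 1ℤ * (C + D)) ≡ A - B * D + E * C
    identity = solve-∀
    eliminate : ∀ {p q t} A B C D E → p ≡ -1ℤ → q ≡ 0ℤ → t ≡ 1ℤ →
      (A - B * (C + D)) - (E - B * (p + q)) * (D - t * (C + D)) ≡ A - B * D + E * C
    eliminate A B C D E refl refl refl = identity A B C D E

  toℕ-punchIn : ∀ {m} (j : Fin (suc m)) (c : Fin m) → toℕ (punchIn j c) ≡ punchInℕ (toℕ j) (toℕ c)
  toℕ-punchIn Fin.zero    c           = refl
  toℕ-punchIn (Fin.suc j) Fin.zero    = refl
  toℕ-punchIn (Fin.suc j) (Fin.suc c) = cong suc (toℕ-punchIn j c)

  sumFin≡sumTo : ∀ {m} (g : Fin m → ℤ) (h : ℕ → ℤ) → (∀ i → g i ≡ h (toℕ i)) → sumFin g ≡ sumTo m h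
  sumFin≡sumTo {zero}  g h g≗h = refl
  sumFin≡sumTo {suc m} g h g≗h = cong₂ _+_ (g≗h Fin.zero) (sumFin≡sumTo (g ∘ Fin.suc) (h ∘ suc) (g≗h ∘ Fin.suc))

  det≡detN : ∀ {m} (A : Matrix m) (f : ℕMatrix) → (∀ i j → A i j ≡ f (toℕ i) (toℕ j)) → det A ≡ detN m f
  det≡detN {zero}  A f A≗f = refl
  det≡detN {suc m} A f A≗f = sumFin≡sumTo _ (cofactorTerm m f) λ j →
    cong₂ (λ x d → sign (toℕ j) * (x * d)) (A≗f Fin.zero j)
      (det≡detN _ (minor f (toℕ j)) λ r c →
        trans (A≗f (Fin.suc r) (punchIn j c)) (cong (f (suc (toℕ r))) (toℕ-punchIn j c)))

module TournamentOfMatrix where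

  open Determinant
  open import Data.Integer using (-_)
  open import Data.Bool using (Bool; true; false; if_then_else_)
  open import Relation.Nullary using (does)

  IsSign : ℤ → Set
  IsSign z = z ≡ 1ℤ ⊎ z ≡ -1ℤ

  IsSign-neg : ∀ {z} → IsSign z → IsSign (- z)
  IsSign-neg (inj₁ refl) = inj₂ refl
  IsSign-neg (inj₂ refl) = inj₁ refl

  Skew : ℕMatrix → Set
  Skew M = ∀ i j → M j i ≡ - M i j

  self-negation⇒0 : ∀ {z} → z ≡ - z → z ≡ 0ℤ
  self-negation⇒0 {+ zero} _ = refl

  isOne : ℤ → Bool
  isOne z = does (z ℤ.≟ 1ℤ)

  isOne-opposite : ∀ {z} → IsSign z → (isOne z ≡ true × isOne (- z) ≡ false) ⊎ (isOne z ≡ false × isOne (- z) ≡ true)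
  isOne-opposite (inj₁ refl) = inj₁ (refl , refl)
  isOne-opposite (inj₂ refl) = inj₂ (refl , refl)

  isOne-sign : ∀ {z} → IsSign z → (if isOne z then 1ℤ else -1ℤ) ≡ z
  isOne-sign (inj₁ refl) = refl
  isOne-sign (inj₂ refl) = refl

  module _ (m : ℕ) (M : ℕMatrix) (skew : Skew M)
           (offDiagonal : ∀ i j → i < m → j < m → i ≢ j → IsSign (M i j)) where

    private
      entry : Fin m → Fin m → ℤ
      entry i j = M (toℕ i) (toℕ j)

      diagonal : ∀ i → entry i i ≡ 0ℤ
      diagonal i = self-negation⇒0 (skew (toℕ i) (toℕ i))

      oneArc : ∀ i j → i ≢ j →
        (isOne (entry i j) ≡ true × isOne (entry j i) ≡ false) ⊎ (isOne (entry i j) ≡ false × isOne (entry j i) ≡ true)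
      oneArc i j i≢j rewrite skew (toℕ i) (toℕ j) =
        isOne-opposite (offDiagonal (toℕ i) (toℕ j) (Fin.toℕ<n i) (Fin.toℕ<n j) (i≢j ∘ Fin.toℕ-injective))

    tournamentOf : Tournament m
    tournamentOf = record
      { arc      = λ i j → isOne (entry i j)
      ; loopless = λ i → cong isOne (diagonal i)
      ; oneOf    = oneArc
      }

    seidel-tournamentOf : ∀ i j → seidel tournamentOf i j ≡ entry i j
    seidel-tournamentOf i j with i Fin.≟ j
    ... | yes refl = sym (diagonal i)
    ... | no  i≢j  = isOne-sign (offDiagonal (toℕ i) (toℕ j) (Fin.toℕ<n i) (Fin.toℕ<n j) (i≢j ∘ Fin.toℕ-injective))

    tournamentOf-det : Σ (Tournament m) (λ T → det (seidel T) ≡ detN m M)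
    tournamentOf-det = tournamentOf , det≡detN (seidel tournamentOf) M seidel-tournamentOf

module Bordered where

  open Determinant
  open TournamentOfMatrix
  open import Data.Integer using (_+_; _*_; _-_; -_)

  transitive : ℕMatrix
  transitive zero    zero    = 0ℤ
  transitive zero    (suc j) = 1ℤ
  transitive (suc i) zero    = -1ℤ
  transitive (suc i) (suc j) = transitive i j

  transitive-skew : Skew transitive
  transitive-skew zero    zero    = refl
  transitive-skew zero    (suc j) = refl
  transitive-skew (suc i) zero    = refl
  transitive-skew (suc i) (suc j) = transitive-skew i j

  transitive-sign : ∀ i j → i ≢ j → IsSign (transitive i j)
  transitive-sign zero    zero    i≢j = contradiction refl i≢j
  transitive-sign zero    (suc j) _   = inj₁ refl
  transitive-sign (suc i) zero    _   = inj₂ refl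
  transitive-sign (suc i) (suc j) i≢j = transitive-sign i j (i≢j ∘ cong suc)

  data Zone : Set where
    inner  : ℕ → Zone
    outerX : Zone
    outerY : Zone

  shiftZone : Zone → Zone
  shiftZone (inner i) = inner (suc i)
  shiftZone outerX    = outerX
  shiftZone outerY    = outerY

  -- Rows and columns 0 … n-1 of the bordered matrix of order n + 2 are inner, n is outerX and
  -- n + 1 is outerY (as is every larger index, where the matrix is never read).
  zone : ℕ → ℕ → Zone
  zone zero    zero    = outerX
  zone zero    (suc _) = outerY
  zone (suc n) zero    = inner 0
  zone (suc n) (suc i) = shiftZone (zone n i)

  index : ℕ → Zone → ℕ
  index n (inner i) = i
  index n outerX    = n
  index n outerY    = suc n

  index-zone : ∀ n i → i < n ℕ.+ 2 → index n (zone n i) ≡ i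
  index-zone zero    zero          _         = refl
  index-zone zero    (suc zero)    _         = refl
  index-zone zero    (suc (suc i)) (s<s (s<s ()))
  index-zone (suc n) zero          _         = refl
  index-zone (suc n) (suc i)       (s<s i<n+2) = trans (index-shiftZone (zone n i)) (cong suc (index-zone n i i<n+2))
    where
    index-shiftZone : ∀ z → index (suc n) (shiftZone z) ≡ suc (index n z)
    index-shiftZone (inner _) = refl
    index-shiftZone outerX    = refl
    index-shiftZone outerY    = refl

  zone-injective : ∀ n i j → i < n ℕ.+ 2 → j < n ℕ.+ 2 → zone n i ≡ zone n j → i ≡ j
  zone-injective n i j i<n+2 j<n+2 eq =
    trans (sym (index-zone n i i<n+2)) (trans (cong (index n) eq) (index-zone n j j<n+2))

  entry : (ℕ → ℤ) → (ℕ → ℤ) → ℤ → Zone → Zone → ℤ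
  entry x y s (inner i) (inner j) = transitive i j
  entry x y s (inner i) outerX    = - x i
  entry x y s (inner i) outerY    = - y i
  entry x y s outerX    (inner j) = x j
  entry x y s outerY    (inner j) = y j
  entry x y s outerX    outerX    = 0ℤ
  entry x y s outerX    outerY    = s
  entry x y s outerY    outerX    = - s
  entry x y s outerY    outerY    = 0ℤ

  bordered : ℕ → (ℕ → ℤ) → (ℕ → ℤ) → ℤ → ℕMatrix
  bordered n x y s r c = entry x y s (zone n r) (zone n c)

  entry-skew : ∀ x y s a b → entry x y s b a ≡ - entry x y s a b
  entry-skew x y s (inner i) (inner j) = transitive-skew i j
  entry-skew x y s (inner i) outerX    = sym (ℤ.neg-involutive (x i))
  entry-skew x y s (inner i) outerY    = sym (ℤ.neg-involutive (y i))
  entry-skew x y s outerX    (inner j) = refl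
  entry-skew x y s outerY    (inner j) = refl
  entry-skew x y s outerX    outerX    = refl
  entry-skew x y s outerX    outerY    = refl
  entry-skew x y s outerY    outerX    = sym (ℤ.neg-involutive s)
  entry-skew x y s outerY    outerY    = refl

  entry-sign : ∀ {x y s} → (∀ i → IsSign (x i)) → (∀ i → IsSign (y i)) → IsSign s →
    ∀ a b → a ≢ b → IsSign (entry x y s a b)
  entry-sign ±x ±y ±s (inner i) (inner j) a≢b = transitive-sign i j (a≢b ∘ cong inner)
  entry-sign ±x ±y ±s (inner i) outerX    _   = IsSign-neg (±x i)
  entry-sign ±x ±y ±s (inner i) outerY    _   = IsSign-neg (±y i)
  entry-sign ±x ±y ±s outerX    (inner j) _   = ±x j
  entry-sign ±x ±y ±s outerY    (inner j) _   = ±y j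
  entry-sign ±x ±y ±s outerX    outerX    a≢b = contradiction refl a≢b
  entry-sign ±x ±y ±s outerX    outerY    _   = ±s
  entry-sign ±x ±y ±s outerY    outerX    _   = IsSign-neg ±s
  entry-sign ±x ±y ±s outerY    outerY    a≢b = contradiction refl a≢b

  bordered-skew : ∀ n x y s → Skew (bordered n x y s)
  bordered-skew n x y s r c = entry-skew x y s (zone n r) (zone n c)

  bordered-offDiagonal : ∀ n {x y s} → (∀ i → IsSign (x i)) → (∀ i → IsSign (y i)) → IsSign s →
    ∀ i j → i < n ℕ.+ 2 → j < n ℕ.+ 2 → i ≢ j → IsSign (bordered n x y s i j)
  bordered-offDiagonal n ±x ±y ±s i j i<n+2 j<n+2 i≢j =
    entry-sign ±x ±y ±s (zone n i) (zone n j) (i≢j ∘ zone-injective n i j i<n+2 j<n+2)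

  shift : (ℕ → ℤ) → ℕ → ℤ
  shift x i = x (2 ℕ.+ i) + x 0 - x 1

  private
    innerInner : ∀ t → t - 1ℤ * -1ℤ + 1ℤ * -1ℤ ≡ t
    innerInner = solve-∀
    innerOuter : ∀ a b c → - a - - b * -1ℤ + - c * -1ℤ ≡ - (a + b - c)
    innerOuter = solve-∀
    outerInner : ∀ a b c → a - 1ℤ * c + 1ℤ * b ≡ a + b - c
    outerInner = solve-∀
    outerDiagonal : ∀ a b → 0ℤ - - a * b + - b * a ≡ 0ℤ
    outerDiagonal = solve-∀
    outerXY : ∀ s x₀ x₁ y₀ y₁ → s - - y₀ * x₁ + - y₁ * x₀ ≡ s + x₁ * y₀ - x₀ * y₁
    outerXY = solve-∀
    outerYX : ∀ s x₀ x₁ y₀ y₁ → - s - - x₀ * y₁ + - x₁ * y₀ ≡ - (s + x₁ * y₀ - x₀ * y₁)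
    outerYX = solve-∀

  entry-step : ∀ x y s a b →
    entry x y s (shiftZone (shiftZone a)) (shiftZone (shiftZone b))
      - entry x y s (inner 0) (shiftZone (shiftZone b)) * entry x y s (shiftZone (shiftZone a)) (inner 1)
      + entry x y s (inner 1) (shiftZone (shiftZone b)) * entry x y s (shiftZone (shiftZone a)) (inner 0)
    ≡ entry (shift x) (shift y) (s + x 1 * y 0 - x 0 * y 1) a b
  entry-step x y s (inner i) (inner j) = innerInner (transitive i j)
  entry-step x y s (inner i) outerX    = innerOuter (x (2 ℕ.+ i)) (x 0) (x 1)
  entry-step x y s (inner i) outerY    = innerOuter (y (2 ℕ.+ i)) (y 0) (y 1)
  entry-step x y s outerX    (inner j) = outerInner (x (2 ℕ.+ j)) (x 0) (x 1)
  entry-step x y s outerY    (inner j) = outerInner (y (2 ℕ.+ j)) (y 0) (y 1)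
  entry-step x y s outerX    outerX    = outerDiagonal (x 0) (x 1)
  entry-step x y s outerX    outerY    = outerXY s (x 0) (x 1) (y 0) (y 1)
  entry-step x y s outerY    outerX    = outerYX s (x 0) (x 1) (y 0) (y 1)
  entry-step x y s outerY    outerY    = outerDiagonal (y 0) (y 1)

  detN-bordered-step : ∀ n x y s →
    detN (suc (suc n) ℕ.+ 2) (bordered (suc (suc n)) x y s) ≡
    detN (n ℕ.+ 2) (bordered n (shift x) (shift y) (s + x 1 * y 0 - x 0 * y 1))
  detN-bordered-step n x y s = trans (detN-pivot₂ (n ℕ.+ 2) {bordered (suc (suc n)) x y s} refl refl refl refl)
    (detN-cong (n ℕ.+ 2) λ r c _ _ → entry-step x y s (zone n r) (zone n c))

module Pfaffian where

  open Determinant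
  open Bordered
  open import Data.Integer using (_+_; _*_; _-_; -_)
  open ≡-Reasoning

  alternating : ℕ → ℕ → ℤ
  alternating p i = sign i + + 2 * + p

  weight : ℕ → ℕ → ℕ → ℤ
  weight P p j = sign j * (1ℤ + + 2 * (+ j + + p) - + 2 * + P)

  weighted : ℕ → ℕ → (ℕ → ℤ) → ℤ
  weighted P p y = sumTo (P ℕ.* 2) (λ j → weight P p j * y j)

  pfaffian : ℕ → ℕ → (ℕ → ℤ) → ℤ → ℤ
  pfaffian P p y s = s + weighted P p y

  shift-alternating : ∀ p i → shift (alternating p) i ≡ alternating (suc p) i
  shift-alternating p i = identity (sign i) (+ p)
    where
    identity : ∀ s p → - - s + + 2 * p + (1ℤ + + 2 * p) - (-1ℤ + + 2 * p) ≡ s + + 2 * (1ℤ + p)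
    identity = solve-∀

  weight-shift : ∀ P p j → weight (suc P) p (2 ℕ.+ j) ≡ weight P (suc p) j
  weight-shift P p j = identity (sign j) (+ j) (+ p) (+ P)
    where
    identity : ∀ s j p P → - - s * (1ℤ + + 2 * (+ 2 + j + p) - + 2 * (1ℤ + P)) ≡ s * (1ℤ + + 2 * (j + (1ℤ + p)) - + 2 * P)
    identity = solve-∀

  sumTo-weight : ∀ P p → sumTo (P ℕ.* 2) (weight P p) ≡ - (+ 2 * + P)
  sumTo-weight zero    p = refl
  sumTo-weight (suc P) p = begin
    weight (suc P) p 0 + (weight (suc P) p 1 + sumTo (P ℕ.* 2) (λ j → weight (suc P) p (2 ℕ.+ j)))
      ≡⟨ cong (λ t → weight (suc P) p 0 + (weight (suc P) p 1 + t))
           (trans (sumTo-cong (P ℕ.* 2) λ j _ → weight-shift P p j) (sumTo-weight P (suc p))) ⟩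
    weight (suc P) p 0 + (weight (suc P) p 1 + - (+ 2 * + P))
      ≡⟨ identity (+ p) (+ P) ⟩
    - (+ 2 * + suc P) ∎
    where
    identity : ∀ p P → 1ℤ * (1ℤ + + 2 * (0ℤ + p) - + 2 * (1ℤ + P)) + (-1ℤ * (1ℤ + + 2 * (1ℤ + p) - + 2 * (1ℤ + P)) + - (+ 2 * P))
                       ≡ - (+ 2 * (1ℤ + P))
    identity = solve-∀

  pfaffian-step : ∀ P p y s →
    pfaffian P (suc p) (shift y) (s + alternating p 1 * y 0 - alternating p 0 * y 1) ≡ pfaffian (suc P) p y s
  pfaffian-step P p y s = begin
    s′ + sumTo (P ℕ.* 2) (λ j → weight P (suc p) j * shift y j)
      ≡⟨ cong (_+_ s′) (sumTo-cong (P ℕ.* 2) λ j _ → distribute (weight P (suc p) j) (y (2 ℕ.+ j)) (y 0) (y 1)) ⟩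
    s′ + sumTo (P ℕ.* 2) (λ j → weight P (suc p) j * y (2 ℕ.+ j) + (y 0 - y 1) * weight P (suc p) j)
      ≡⟨ cong (_+_ s′) (sumTo-linear (P ℕ.* 2) (y 0 - y 1) (λ j → weight P (suc p) j * y (2 ℕ.+ j)) (weight P (suc p))) ⟩
    s′ + (sumTo (P ℕ.* 2) (λ j → weight P (suc p) j * y (2 ℕ.+ j)) + (y 0 - y 1) * sumTo (P ℕ.* 2) (weight P (suc p)))
      ≡⟨ cong₂ (λ t u → s′ + (t + (y 0 - y 1) * u))
           (sumTo-cong (P ℕ.* 2) λ j _ → cong (λ w → w * y (2 ℕ.+ j)) (sym (weight-shift P p j)))
           (sumTo-weight P (suc p)) ⟩
    s′ + (tail + (y 0 - y 1) * - (+ 2 * + P))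
      ≡⟨ identity s (y 0) (y 1) tail (+ p) (+ P) ⟩
    pfaffian (suc P) p y s ∎
    where
    s′ tail : ℤ
    s′   = s + alternating p 1 * y 0 - alternating p 0 * y 1
    tail = sumTo (P ℕ.* 2) (λ j → weight (suc P) p (2 ℕ.+ j) * y (2 ℕ.+ j))
    distribute : ∀ w a b c → w * (a + b - c) ≡ w * a + (b - c) * w
    distribute = solve-∀
    identity : ∀ s y₀ y₁ t p P →
      s + (-1ℤ + + 2 * p) * y₀ - (1ℤ + + 2 * p) * y₁ + (t + (y₀ - y₁) * - (+ 2 * P)) ≡
      s + (1ℤ * (1ℤ + + 2 * (0ℤ + p) - + 2 * (1ℤ + P)) * y₀ + (-1ℤ * (1ℤ + + 2 * (1ℤ + p) - + 2 * (1ℤ + P)) * y₁ + t))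
    identity = solve-∀

  bordered-cong : ∀ n {x x′} y s → (∀ i → x i ≡ x′ i) → ∀ r c → bordered n x y s r c ≡ bordered n x′ y s r c
  bordered-cong n {x} {x′} y s x≗x′ r c = entry-cong (zone n r) (zone n c)
    where
    entry-cong : ∀ a b → entry x y s a b ≡ entry x′ y s a b
    entry-cong (inner i) outerX    = cong -_ (x≗x′ i)
    entry-cong outerX    (inner j) = x≗x′ j
    entry-cong (inner i) (inner j) = refl
    entry-cong (inner i) outerY    = refl
    entry-cong outerY    (inner j) = refl
    entry-cong outerX    outerX    = refl
    entry-cong outerX    outerY    = refl
    entry-cong outerY    outerX    = refl
    entry-cong outerY    outerY    = refl

  detN-bordered-alternating : ∀ P p y s →
    detN (P ℕ.* 2 ℕ.+ 2) (bordered (P ℕ.* 2) (alternating p) y s) ≡ pfaffian P p y s * pfaffian P p y s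
  detN-bordered-alternating zero    p y s = identity s
    where
    identity : ∀ s → 1ℤ * (0ℤ * (1ℤ * (0ℤ * 1ℤ) + 0ℤ)) + (-1ℤ * (s * (1ℤ * (- s * 1ℤ) + 0ℤ)) + 0ℤ) ≡ (s + 0ℤ) * (s + 0ℤ)
    identity = solve-∀
  detN-bordered-alternating (suc P) p y s = begin
    detN (suc P ℕ.* 2 ℕ.+ 2) (bordered (suc P ℕ.* 2) (alternating p) y s)
      ≡⟨ detN-bordered-step (P ℕ.* 2) (alternating p) y s ⟩
    detN (P ℕ.* 2 ℕ.+ 2) (bordered (P ℕ.* 2) (shift (alternating p)) (shift y) s′)
      ≡⟨ detN-cong (P ℕ.* 2 ℕ.+ 2) (λ r c _ _ → bordered-cong (P ℕ.* 2) (shift y) s′ (shift-alternating p) r c) ⟩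
    detN (P ℕ.* 2 ℕ.+ 2) (bordered (P ℕ.* 2) (alternating (suc p)) (shift y) s′)
      ≡⟨ detN-bordered-alternating P (suc p) (shift y) s′ ⟩
    pfaffian P (suc p) (shift y) s′ * pfaffian P (suc p) (shift y) s′
      ≡⟨ cong (λ f → f * f) (pfaffian-step P p y s) ⟩
    pfaffian (suc P) p y s * pfaffian (suc P) p y s ∎
    where
    s′ : ℤ
    s′ = s + alternating p 1 * y 0 - alternating p 0 * y 1

module SignChoice where

  open Determinant
  open TournamentOfMatrix
  open Pfaffian
  open import Data.Integer using (_+_; _*_; _-_; -_)
  open ≡-Reasoning

  -- Both end weights of level suc P are -(2P + 1) and its inner weights are those of level P
  -- negated, hence the - y j.
  extend : ℕ → (ℕ → ℤ) → ℤ → ℤ → ℕ → ℤ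
  extend P y e e′ zero = e
  extend P y e e′ (suc j) with j <? P ℕ.* 2
  ... | yes _ = - y j
  ... | no  _ = e′

  extend-< : ∀ P y e e′ j → j < P ℕ.* 2 → extend P y e e′ (suc j) ≡ - y j
  extend-< P y e e′ j j<2P with j <? P ℕ.* 2
  ... | yes _    = refl
  ... | no  j≮2P = contradiction j<2P j≮2P

  extend-last : ∀ P y e e′ → extend P y e e′ (suc (P ℕ.* 2)) ≡ e′
  extend-last P y e e′ with P ℕ.* 2 <? P ℕ.* 2
  ... | yes 2P<2P = contradiction 2P<2P (ℕ.<-irrefl refl)
  ... | no  _     = refl

  extend-sign : ∀ P {y e e′} → (∀ i → IsSign (y i)) → IsSign e → IsSign e′ → ∀ i → IsSign (extend P y e e′ i)
  extend-sign P ±y ±e ±e′ zero = ±e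
  extend-sign P ±y ±e ±e′ (suc j) with j <? P ℕ.* 2
  ... | yes _ = IsSign-neg (±y j)
  ... | no  _ = ±e′

  sign-even : ∀ P → sign (P ℕ.* 2) ≡ 1ℤ
  sign-even zero    = refl
  sign-even (suc P) = trans (ℤ.neg-involutive (sign (P ℕ.* 2))) (sign-even P)

  weighted-extend : ∀ P y e e′ → weighted (suc P) 0 (extend P y e e′) ≡ weighted P 0 y - (1ℤ + + 2 * + P) * (e + e′)
  weighted-extend P y e e′ = begin
    g 0 + sumTo (suc (P ℕ.* 2)) (g ∘ suc)
      ≡⟨ cong (_+_ (g 0)) (sumTo-snoc (P ℕ.* 2) (g ∘ suc)) ⟩
    g 0 + (sumTo (P ℕ.* 2) (g ∘ suc) + g (suc (P ℕ.* 2)))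
      ≡⟨ cong₂ (λ a b → g 0 + (a + b)) (sumTo-cong (P ℕ.* 2) middle)
           (lastTerm (sign-even P) (ℤ.pos-* P 2) (extend-last P y e e′)) ⟩
    g 0 + (weighted P 0 y + - (1ℤ + + 2 * + P) * e′)
      ≡⟨ outer (weighted P 0 y) e e′ (+ P) ⟩
    weighted P 0 y - (1ℤ + + 2 * + P) * (e + e′) ∎
    where
    g : ℕ → ℤ
    g j = weight (suc P) 0 j * extend P y e e′ j
    negateBoth : ∀ s j P y → - s * (1ℤ + + 2 * ((1ℤ + j) + 0ℤ) - + 2 * (1ℤ + P)) * - y ≡ s * (1ℤ + + 2 * (j + 0ℤ) - + 2 * P) * y
    negateBoth = solve-∀
    middle : ∀ j → j < P ℕ.* 2 → g (suc j) ≡ weight P 0 j * y j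
    middle j j<2P =
      trans (cong (_*_ (weight (suc P) 0 (suc j))) (extend-< P y e e′ j j<2P)) (negateBoth (sign j) (+ j) (+ P) (y j))
    last : ∀ P e′ → - 1ℤ * (1ℤ + + 2 * ((1ℤ + P * + 2) + 0ℤ) - + 2 * (1ℤ + P)) * e′ ≡ - (1ℤ + + 2 * P) * e′
    last = solve-∀
    lastTerm : ∀ {s K z} → s ≡ 1ℤ → K ≡ + P * + 2 → z ≡ e′ →
      - s * (1ℤ + + 2 * ((1ℤ + K) + 0ℤ) - + 2 * (1ℤ + + P)) * z ≡ - (1ℤ + + 2 * + P) * e′
    lastTerm refl refl refl = last (+ P) e′
    outer : ∀ σ e e′ P →
      1ℤ * (1ℤ + + 2 * (0ℤ + 0ℤ) - + 2 * (1ℤ + P)) * e + (σ + - (1ℤ + + 2 * P) * e′) ≡ σ - (1ℤ + + 2 * P) * (e + e′)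
    outer = solve-∀

  -- The |weights| sum to P² + P², and W is the part of it on which y disagrees with their signs.
  Attains : ℕ → ℕ → Set
  Attains P W = ∃[ y ] (∀ i → IsSign (y i)) × weighted P 0 y + (+ W + + W) ≡ + (P ℕ.* P) + + (P ℕ.* P)

  private
    bound : ℕ → ℕ
    bound P = P ℕ.* P ℕ.+ P ℕ.* P

    newWeight : ℕ → ℕ
    newWeight P = suc (P ℕ.+ P)

    n≤n*n : ∀ n → n ≤ n ℕ.* n
    n≤n*n zero    = z≤n
    n≤n*n (suc n) = ℕ.m≤m*n (suc n) (suc n)

    newWeight≤1+bound : ∀ P → newWeight P ≤ suc (bound P)
    newWeight≤1+bound P = s≤s (ℕ.+-mono-≤ (n≤n*n P) (n≤n*n P))

    newWeight≤ : ∀ P {W} → ¬ W ≤ bound P → newWeight P ≤ W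
    newWeight≤ P W≰B = ℕ.≤-trans (newWeight≤1+bound P) (ℕ.≰⇒> W≰B)

    twiceNewWeight≤ : ∀ P {W} → ¬ W ≤ bound P ℕ.+ newWeight P → newWeight P ℕ.+ newWeight P ≤ W
    twiceNewWeight≤ P W≰B+K = ℕ.≤-trans (ℕ.+-monoˡ-≤ (newWeight P) (newWeight≤1+bound P)) (ℕ.≰⇒> W≰B+K)

    square-suc : ∀ P → suc P ℕ.* suc P ≡ P ℕ.* P ℕ.+ suc (P ℕ.+ P)
    square-suc = ℕ-Solver.solve-∀

    regroup : ∀ Q K → Q ℕ.+ K ℕ.+ (Q ℕ.+ K) ≡ (K ℕ.+ K) ℕ.+ (Q ℕ.+ Q)
    regroup = ℕ-Solver.solve-∀

    bound-suc : ∀ P → bound (suc P) ≡ newWeight P ℕ.+ newWeight P ℕ.+ bound P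
    bound-suc P = trans (cong (λ n → n ℕ.+ n) (square-suc P)) (regroup (P ℕ.* P) (newWeight P))

    decompose : ∀ D W B → D ≤ W → W ≤ D ℕ.+ B → ∃[ o ] o ≤ B × D ℕ.+ o ≡ W
    decompose D W B D≤W W≤D+B with o , refl ← ℕ.m≤n⇒∃[o]m+o≡n D≤W = o , ℕ.+-cancelˡ-≤ D o B W≤D+B , refl

  attains-extend : ∀ P W₀ W e e′ → IsSign e → IsSign e′ →
    (∀ σ → σ - (1ℤ + + 2 * + P) * (e + e′) + (+ W + + W) ≡ σ + (+ W₀ + + W₀) + (+ suc (P ℕ.+ P) + + suc (P ℕ.+ P))) →
    Attains P W₀ → Attains (suc P) W
  attains-extend P W₀ W e e′ ±e ±e′ shape (y , ±y , eq) = extend P y e e′ , extend-sign P ±y ±e ±e′ , (begin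
    weighted (suc P) 0 (extend P y e e′) + (+ W + + W)   ≡⟨ cong (λ σ → σ + (+ W + + W)) (weighted-extend P y e e′) ⟩
    weighted P 0 y - (1ℤ + + 2 * + P) * (e + e′) + (+ W + + W)
                                                        ≡⟨ shape (weighted P 0 y) ⟩
    weighted P 0 y + (+ W₀ + + W₀) + (+ K + + K)        ≡⟨ cong (λ t → t + (+ K + + K)) eq ⟩
    + Q + + Q + (+ K + + K)                             ≡⟨ interchange (+ Q) (+ K) ⟩
    (+ Q + + K) + (+ Q + + K)                           ≡⟨ cong (λ n → + n + + n) (square-suc P) ⟨
    + (suc P ℕ.* suc P) + + (suc P ℕ.* suc P) ∎)
    where
    Q K : ℕ
    Q = P ℕ.* P
    K = suc (P ℕ.+ P)
    interchange : ∀ q k → q + q + (k + k) ≡ (q + k) + (q + k)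
    interchange = solve-∀

  -- The two new weights have absolute value 2P + 1: flip none, one or both of them.
  attains : ∀ P W → W ≤ bound P → Attains P W
  attains zero    zero    _ = (λ _ → 1ℤ) , (λ _ → inj₁ refl) , refl
  attains (suc P) W W≤B′ with W ℕ.≤? bound P | W ℕ.≤? bound P ℕ.+ newWeight P
  ... | yes W≤B | _ =
    attains-extend P W W -1ℤ -1ℤ (inj₂ refl) (inj₂ refl) (flipNone (+ W) (+ P)) (attains P W W≤B)
    where
    flipNone : ∀ w p σ →
      σ - (1ℤ + + 2 * p) * (-1ℤ + -1ℤ) + (w + w) ≡ σ + (w + w) + ((1ℤ + (p + p)) + (1ℤ + (p + p)))
    flipNone = solve-∀
  ... | no W≰B | yes W≤B+K
    with o , o≤B , refl ← decompose (newWeight P) W (bound P) (newWeight≤ P W≰B)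
                             (subst (W ≤_) (ℕ.+-comm (bound P) (newWeight P)) W≤B+K) =
    attains-extend P o W 1ℤ -1ℤ (inj₁ refl) (inj₂ refl) (flipOne (+ o) (+ P)) (attains P o o≤B)
    where
    flipOne : ∀ w p σ →
      σ - (1ℤ + + 2 * p) * (1ℤ + -1ℤ) + (((1ℤ + (p + p)) + w) + ((1ℤ + (p + p)) + w))
        ≡ σ + (w + w) + ((1ℤ + (p + p)) + (1ℤ + (p + p)))
    flipOne = solve-∀
  ... | no _ | no W≰B+K
    with o , o≤B , refl ← decompose (newWeight P ℕ.+ newWeight P) W (bound P) (twiceNewWeight≤ P W≰B+K)
                             (subst (W ≤_) (bound-suc P) W≤B′) =
    attains-extend P o W 1ℤ 1ℤ (inj₁ refl) (inj₁ refl) (flipBoth (+ o) (+ P)) (attains P o o≤B)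
    where
    flipBoth : ∀ w p σ →
      σ - (1ℤ + + 2 * p) * (1ℤ + 1ℤ) + ((((1ℤ + (p + p)) + (1ℤ + (p + p))) + w) + (((1ℤ + (p + p)) + (1ℤ + (p + p))) + w))
        ≡ σ + (w + w) + ((1ℤ + (p + p)) + (1ℤ + (p + p)))
    flipBoth = solve-∀

  pfaffian-odd : ∀ P t → t ≤ P ℕ.* P → ∃[ y ] (∀ i → IsSign (y i)) × pfaffian P 0 y 1ℤ ≡ + suc (t ℕ.+ t)
  pfaffian-odd P t t≤P²
    with W , t+W≡P² ← ℕ.m≤n⇒∃[o]m+o≡n t≤P²
    with y , ±y , eq ← attains P W (ℕ.≤-trans (ℕ.m+n≤o⇒n≤o t (ℕ.≤-reflexive t+W≡P²)) (ℕ.m≤m+n _ _))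
    = y , ±y , (begin
      1ℤ + weighted P 0 y
        ≡⟨ pad (weighted P 0 y) (+ W) ⟩
      1ℤ + (weighted P 0 y + (+ W + + W)) - (+ W + + W)
        ≡⟨ cong (λ z → 1ℤ + z - (+ W + + W)) (trans eq (cong (λ n → + n + + n) (sym t+W≡P²))) ⟩
      1ℤ + ((+ t + + W) + (+ t + + W)) - (+ W + + W)
        ≡⟨ cancel (+ t) (+ W) ⟩
      1ℤ + (+ t + + t) ∎)
    where
    pad : ∀ σ w → 1ℤ + σ ≡ 1ℤ + (σ + (w + w)) - (w + w)
    pad = solve-∀
    cancel : ∀ t w → 1ℤ + ((t + w) + (t + w)) - (w + w) ≡ 1ℤ + (t + t)
    cancel = solve-∀

  alternating-sign : ∀ i → IsSign (alternating 0 i)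
  alternating-sign i = subst IsSign (sym (ℤ.+-identityʳ (sign i))) (sign-sign i)
    where
    sign-sign : ∀ i → IsSign (sign i)
    sign-sign zero    = inj₁ refl
    sign-sign (suc i) = IsSign-neg (sign-sign i)

open Determinant using (ℕMatrix; detN)
open TournamentOfMatrix using (tournamentOf-det)
open Bordered using (bordered; bordered-skew; bordered-offDiagonal)
open Pfaffian using (alternating; pfaffian; detN-bordered-alternating)
open SignChoice using (pfaffian-odd; alternating-sign)
open import Data.Nat using (_+_; _*_)
open import Data.Nat.Divisibility using (_∣_; divides; ∣-refl; ∣m∣n⇒∣m+n)

¬2∣⇒odd : ∀ k → ¬ (2 ∣ k) → ∃[ t ] k ≡ suc (t + t)
¬2∣⇒odd zero          2∤0   = contradiction (divides 0 refl) 2∤0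
¬2∣⇒odd (suc zero)    _     = 0 , refl
¬2∣⇒odd (suc (suc k)) 2∤k+2 with t , refl ← ¬2∣⇒odd k (2∤k+2 ∘ ∣m∣n⇒∣m+n ∣-refl) =
  suc t , cong (suc ∘ suc) (sym (ℕ.+-suc t t))

half-bound : ∀ P t → 2 * suc (t + t) < P * 2 * (P * 2) + 2 → t ≤ P * P
half-bound P t bound =
  ℕ.<⇒≤ (ℕ.*-cancelˡ-< 4 t (P * P) (ℕ.+-cancelʳ-< 2 (4 * t) (4 * (P * P)) (subst₂ _<_ (lhs t) (rhs P) bound)))
  where
  lhs : ∀ t → 2 * suc (t + t) ≡ 4 * t + 2
  lhs = ℕ-Solver.solve-∀
  rhs : ∀ P → P * 2 * (P * 2) + 2 ≡ 4 * (P * P) + 2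
  rhs = ℕ-Solver.solve-∀

-- The proof uses let rather than with, since
-- abstracting over a goal that mentions det would normalise it.
theorem3p2 : (n k : ℕ) → 0 < n → 2 ∣ n → 0 < k → ¬ (2 ∣ k) → 2 * k < n * n + 2 →
    Σ (Tournament (n + 2)) (λ T → det (seidel T) ≡ ℤ.+ (k * k))
theorem3p2 n k _ (divides P refl) _ 2∤k bound =
  let t , k≡2t+1       = ¬2∣⇒odd k 2∤k
      y , ±y , pf≡2t+1 = pfaffian-odd P t (half-bound P t (subst (λ m → 2 * m < P * 2 * (P * 2) + 2) k≡2t+1 bound))
      M : ℕMatrix
      M                = bordered (P * 2) (alternating 0) y 1ℤ
      T , det≡detN     = tournamentOf-det (P * 2 + 2) M (bordered-skew (P * 2) (alternating 0) y 1ℤ)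
                           (bordered-offDiagonal (P * 2) alternating-sign ±y (inj₁ refl))
  in T , (begin
    det (seidel T)                                  ≡⟨ det≡detN ⟩
    detN (P * 2 + 2) M                              ≡⟨ detN-bordered-alternating P 0 y 1ℤ ⟩
    pfaffian P 0 y 1ℤ ℤ.* pfaffian P 0 y 1ℤ        ≡⟨ cong (λ z → z ℤ.* z) pf≡2t+1 ⟩
    ℤ.+ suc (t + t) ℤ.* ℤ.+ suc (t + t)             ≡⟨ ℤ.pos-* (suc (t + t)) (suc (t + t)) ⟨
    ℤ.+ (suc (t + t) * suc (t + t))                 ≡⟨ cong (λ m → ℤ.+ (m * m)) k≡2t+1 ⟨
    ℤ.+ (k * k) ∎)
  where open ≡-Reasoning
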